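{- Let $\mathfrak{M}=(W,R,V)$ be a BPL-model and let $\mathfrak{J}^{\mathfrak{M}}=(W',R',V')$ be the ternary model constructed from $\mathfrak{M}$. Then for every $\mathcal{L}_{\mathrm{BPL}}$-formula $A$, every $a\in W$ and every $i\in\{1,2\}$: $\mathfrak{M},a\models A$ if and only if $\mathfrak{J}^{\mathfrak{M}},a_i\models A$.
   Context: $\mathcal{L}_{\mathrm{BPL}}$-formulas are built from propositional letters and $\bot,\top$ by $\wedge,\vee,\rightarrow$. A BPL-model is $\mathfrak{M}=(W,R,V)$ with $W$ nonempty, $R\subseteq W^2$ transitive, and $V$ assigning to each propositional letter a subset of $W$ such that $w\in V(p)$ and $wRu$ imply $u\in V(p)$. Satisfaction: $\mathfrak{M},w\models p$ iff $w\in V(p)$; $\top$ always true, $\bot$ never; $\wedge,\vee$ pointwise; $\mathfrak{M},w\models A\rightarrow B$ iff for all $v$ with $wRv$, $\mathfrak{M},v\models A$ implies $\mathfrak{M},v\models B$. A ternary model is $\mathfrak{J}=(W',R',V')$ with $W'$ nonempty, $R'\subseteq W'^3$, $V'$ a valuation; satisfaction: $p$ via $V'$; $\top$ always, $\bot$ never; $\wedge,\vee$ pointwise; $\mathfrak{J},a\models A\cdot B$ iff there are $x,y$ with $R'(a,x,y)$, $\mathfrak{J},x\models A$, $\mathfrak{J},y\models B$; $\mathfrak{J},a\models A\leftarrow B$ iff for all $x,y$ with $R'(x,a,y)$, $\mathfrak{J},y\models B$ implies $\mathfrak{J},x\models A$; $\mathfrak{J},a\models A\rightarrow B$ iff for all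 $x,y$ with $R'(x,y,a)$, $\mathfrak{J},y\models A$ implies $\mathfrak{J},x\models B$. Given a BPL-model $\mathfrak{M}=(W,R,V)$, $\mathfrak{J}^{\mathfrak{M}}=(W',R',V')$ is defined by: $W'=\{a_1,a_2: a\in W\}$ (two distinct copies of each state); $R'=\{(b_1,b_2,a_1),(b_2,b_1,a_1),(b_1,b_2,a_2),(b_2,b_1,a_2): a,b\in W,\ aRb\}$; $V'(p)=\{a_i: i\in\{1,2\},\ a\in V(p)\}$. -}

module Defs where

open import Data.Nat using (ℕ)
open import Data.Product using (Σ; _×_; _,_; proj₁)
open import Relation.Binary.PropositionalEquality using (_≡_)
open import Data.Sum using (_⊎_)
open import Data.Unit using (⊤)
open import Data.Empty using (⊥)
open import Data.Bool using (Bool; true; false)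

Letter : Set
Letter = ℕ

data Fm : Set where
  var  : Letter → Fm
  ⊥f   : Fm
  ⊤f   : Fm
  _∧f_ : Fm → Fm → Fm
  _∨f_ : Fm → Fm → Fm
  _⇒f_ : Fm → Fm → Fm

record BPLModel : Set₁ where
  field
    W      : Set
    inhabited : W
    R      : W → W → Set
    R-trans : ∀ {x y z} → R x y → R y z → R x z
    V      : Letter → W → Set
    V-pers : ∀ {p w u} → V p w → R w u → V p u

_,_⊨_ : (M : BPLModel) → BPLModel.W M → Fm → Set
M , w ⊨ var p   = BPLModel.V M p w
M , w ⊨ ⊥f      = ⊥
M , w ⊨ ⊤f      = ⊤
M , w ⊨ (A ∧f B) = (M , w ⊨ A) × (M , w ⊨ B)
M , w ⊨ (A ∨f B) = (M , w ⊨ A) ⊎ (M , w ⊨ B)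
M , w ⊨ (A ⇒f B) = ∀ v → BPLModel.R M w v → M , v ⊨ A → M , v ⊨ B

data TFm : Set where
  var  : Letter → TFm
  ⊥t   : TFm
  ⊤t   : TFm
  _∧t_ : TFm → TFm → TFm
  _∨t_ : TFm → TFm → TFm
  _·t_ : TFm → TFm → TFm
  _⇐t_ : TFm → TFm → TFm
  _⇒t_ : TFm → TFm → TFm

record TernaryModel : Set₁ where
  field
    W' : Set
    inhabited : W'
    R' : W' → W' → W' → Set
    V' : Letter → W' → Set

_,_⊩_ : (J : TernaryModel) → TernaryModel.W' J → TFm → Set
J , a ⊩ var p    = TernaryModel.V' J p a
J , a ⊩ ⊥t       = ⊥
J , a ⊩ ⊤t       = ⊤
J , a ⊩ (A ∧t B) = (J , a ⊩ A) × (J , a ⊩ B)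
J , a ⊩ (A ∨t B) = (J , a ⊩ A) ⊎ (J , a ⊩ B)
J , a ⊩ (A ·t B) = Σ (TernaryModel.W' J) λ x → Σ (TernaryModel.W' J) λ y →
                     TernaryModel.R' J a x y × (J , x ⊩ A) × (J , y ⊩ B)
J , a ⊩ (A ⇐t B) = ∀ x y → TernaryModel.R' J x a y → J , y ⊩ B → J , x ⊩ A
J , a ⊩ (A ⇒t B) = ∀ x y → TernaryModel.R' J x y a → J , y ⊩ A → J , x ⊩ B

embed : Fm → TFm
embed (var p)  = var p
embed ⊥f       = ⊥t
embed ⊤f       = ⊤t
embed (A ∧f B) = embed A ∧t embed B
embed (A ∨f B) = embed A ∨t embed B
embed (A ⇒f B) = embed A ⇒t embed B

-- Copies: a₁ = (a , true), a₂ = (a , false)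
Idx : Set
Idx = Bool

R'ᴹ : (M : BPLModel) → (BPLModel.W M × Idx) → (BPLModel.W M × Idx) → (BPLModel.W M × Idx) → Set
R'ᴹ M (b , true)  (b' , false) (a , k) = (b ≡ b') × BPLModel.R M a b
R'ᴹ M (b , false) (b' , true)  (a , k) = (b ≡ b') × BPLModel.R M a b
R'ᴹ M (b , true)  (b' , true)  (a , k) = ⊥
R'ᴹ M (b , false) (b' , false) (a , k) = ⊥

J^ : BPLModel → TernaryModel
J^ M = record
  { W' = BPLModel.W M × Idx
  ; inhabited = (BPLModel.inhabited M , true)
  ; R' = R'ᴹ M
  ; V' = λ p x → BPLModel.V M p (proj₁ x)
  }

-- Every ternary triple ending at a copy aₖ has the form (bⱼ, b_{¬j}, aₖ) with a R b, and each
-- such triple is present. So → at aₖ ranges, up to the choice of copies, over the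
-- R-successors of a; as satisfaction is independent of the copy (induction hypothesis),
-- this is exactly BPL implication.
module Submission where

open import Defs
open import Data.Bool using (Bool; true; false; not)
open import Data.Product using (_,_; _×_)
open import Data.Product.Function.NonDependent.Propositional using (_×-⇔_)
open import Data.Sum.Function.Propositional using (_⊎-⇔_)
open import Function.Base using (id)
open import Function.Bundles using (_⇔_; mk⇔; Equivalence)
open import Relation.Binary.PropositionalEquality using (refl)

module _ (M : BPLModel) where
  open BPLModel M

  R'ᴹ-intro : ∀ {a b} (j k : Bool) → R a b → R'ᴹ M (b , j) (b , not j) (a , k)
  R'ᴹ-intro true  k r = refl , r
  R'ᴹ-intro false k r = refl , r

  data R'ᴹ-View (a : W) : W × Bool → W × Bool → Set where
    copies : ∀ {b} j → R a b → R'ᴹ-View a (b , j) (b , not j)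

  R'ᴹ-view : ∀ {a k} x y → R'ᴹ M x y (a , k) → R'ᴹ-View a x y
  R'ᴹ-view (b , true)  (.b , false) (refl , r) = copies true r
  R'ᴹ-view (b , false) (.b , true)  (refl , r) = copies false r

  ⊨⇔⊩ : ∀ A a i → (M , a ⊨ A) ⇔ (J^ M , (a , i) ⊩ embed A)
  ⊨⇔⊩ (var p)  a i = mk⇔ id id
  ⊨⇔⊩ ⊥f       a i = mk⇔ id id
  ⊨⇔⊩ ⊤f       a i = mk⇔ id id
  ⊨⇔⊩ (A ∧f B) a i = ⊨⇔⊩ A a i ×-⇔ ⊨⇔⊩ B a i
  ⊨⇔⊩ (A ∨f B) a i = ⊨⇔⊩ A a i ⊎-⇔ ⊨⇔⊩ B a i
  ⊨⇔⊩ (A ⇒f B) a i = mk⇔ forth back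
    where
    open Equivalence

    forth : M , a ⊨ (A ⇒f B) → J^ M , (a , i) ⊩ embed (A ⇒f B)
    forth h x y r' with R'ᴹ-view x y r'
    ... | copies {b} j r = λ y⊩A →
      to (⊨⇔⊩ B b j) (h b r (from (⊨⇔⊩ A b (not j)) y⊩A))

    back : J^ M , (a , i) ⊩ embed (A ⇒f B) → M , a ⊨ (A ⇒f B)
    back h b r b⊨A = from (⊨⇔⊩ B b true)
      (h (b , true) (b , false) (R'ᴹ-intro true i r) (to (⊨⇔⊩ A b false) b⊨A))

lemma1 : (M : BPLModel) (A : Fm) (a : BPLModel.W M) (i : Bool) →
    (M , a ⊨ A) ⇔ (J^ M , (a , i) ⊩ embed A)
lemma1 = ⊨⇔⊩
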